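{- Let $k = 2j$ for a positive integer $j$. Then there is a graph $G$ with $|V(G)| = 2^{k-1} + k - 2$ and $\textrm{RED:LD}(G) = k$.
   Context: $N(v)$ denotes the open neighborhood of $v$. A set $S \subseteq V(G)$ is a locating-dominating (LD) set if for all $u,v \in V(G)-S$: $N(v)\cap S \neq \varnothing$, and if $u \ne v$ then $N(v) \cap S \neq N(u) \cap S$. A RED:LD set is an LD set $S$ such that $S-\{v\}$ is an LD set for every $v \in S$. $\textrm{RED:LD}(G)$ denotes the minimum cardinality of a RED:LD set of $G$. -}

module Defs where

open import Data.Nat using (ℕ; _≤_; _+_; _∸_; _^_)
open import Data.Fin using (Fin)
open import Data.Fin.Subset using (Subset; _∈_; _∉_; ∣_∣; _-_)
open import Data.Bool using (Bool; true; false)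
open import Data.Product using (Σ; _×_; ∃-syntax)
open import Relation.Binary.PropositionalEquality using (_≡_; _≢_)
open import Relation.Nullary using (¬_)

record Graph (n : ℕ) : Set where
  field
    adj   : Fin n → Fin n → Bool
    sym   : ∀ u v → adj u v ≡ adj v u
    irrfl : ∀ v → adj v v ≡ false
open Graph public

Adj : ∀ {n} → Graph n → Fin n → Fin n → Set
Adj G u v = adj G u v ≡ true

Dominated : ∀ {n} → Graph n → Subset n → Fin n → Set
Dominated G S v = ∃[ w ] (w ∈ S × Adj G v w)

Separated : ∀ {n} → Graph n → Subset n → Fin n → Fin n → Set
Separated G S u v = ¬ (∀ w → w ∈ S → (Adj G u w → Adj G v w) × (Adj G v w → Adj G u w))

IsLD : ∀ {n} → Graph n → Subset n → Set
IsLD G S =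
  (∀ v → v ∉ S → Dominated G S v) ×
  (∀ u v → u ∉ S → v ∉ S → u ≢ v → Separated G S u v)

IsREDLD : ∀ {n} → Graph n → Subset n → Set
IsREDLD G S = IsLD G S × (∀ v → v ∈ S → IsLD G (S - v))

REDLDNumberIs : ∀ {n} → Graph n → ℕ → Set
REDLDNumberIs G k =
  (∃[ S ] (IsREDLD G S × ∣ S ∣ ≡ k)) ×
  (∀ S → IsREDLD G S → k ≤ ∣ S ∣)

module Submission where

-- Lower bound: if S is a RED:LD set of a graph on n vertices, attach to each vertex v its
-- trace on S, namely {v} for v ∈ S and N(v) ∩ S for v ∉ S. These n traces are pairwise
-- distinct and non-empty; the only delicate case, N(v) ∩ S = {u} with u ∈ S, is excluded
-- because v must still be dominated by S - {u}. Hence n + 1 ≤ 2^|S|.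
--
-- Construction for even k: a clique K on k vertices plus 2^(k-1) - 2 independent vertices
-- whose neighbourhoods in K are the even-weight words of length k other than ∅ and K (for
-- even k the all-ones word has even weight). Distinct even-weight words differ in at least
-- two coordinates, so whichever clique vertex is deleted, some other coordinate still tells
-- any two of these neighbourhoods (and ∅, K) apart; hence K is a RED:LD set. The graph has
-- 2^(k-1) + k - 2 ≥ 2^(k-1) vertices, so by the lower bound every RED:LD set has ≥ k elements.

open import Defs hiding (sym)
open import Data.Nat using (ℕ; zero; suc; _+_; _*_; _∸_; _^_; _≤_; _<_; z≤n; s≤s)
import Data.Nat.Properties as ℕ
open import Data.Nat.Properties
  using (≰⇒>; <⇒≱; ≤-<-trans; <⇒≤; <-irrefl; ^-monoʳ-≤; +-suc; +-identityʳ; +-comm;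
         +-monoˡ-≤; +-monoʳ-≤; m∸n+n≡m; +-∸-assoc; module ≤-Reasoning)
open import Data.Fin
  using (Fin; zero; suc; toℕ; fromℕ<; splitAt; combine; finToFun; funToFin; _↑ˡ_; _↑ʳ_; _≟_)
open import Data.Fin.Properties
  using (suc-injective; toℕ-injective; toℕ-fromℕ<; fromℕ<-injective; toℕ<n; toℕ-↑ˡ; toℕ-↑ʳ;
         ↑ˡ-injective; splitAt-↑ˡ; splitAt-↑ʳ; splitAt⁻¹-↑ˡ; splitAt⁻¹-↑ʳ;
         combine-injectiveˡ; combine-injectiveʳ; funToFin-finToFin; 2↔Bool;
         injective⇒≤; any?; ¬∀⟶∃¬)
open import Data.Fin.Subset using (Subset; _∈_; _∉_; ∣_∣; _-_; _─_; ⁅_⁆; ⊤; ⊥; _⊆_)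
open import Data.Fin.Subset.Properties
  using (_∈?_; p─q⊆p; x∉⁅y⁆⇒x≢y; x∈p∧x≢y⇒x∈p-y; ∉⊥; ∣⊥∣≡0)
open import Data.Vec using ([]; _∷_; _++_; here; there)
open import Data.Vec.Properties using (∷-injective)
open import Data.Bool using (Bool; true; false; not; _xor_)
import Data.Bool.Properties as Bool
open import Data.Bool.Properties using (not-distribˡ-xor; not-distribʳ-xor; not-¬; ¬-not)
open import Data.Sum using (_⊎_; inj₁; inj₂)
open import Data.Product using (_×_; _,_; proj₁; proj₂; swap; ∃-syntax)
open import Function using (_∘_; Inverse; Injection; mk⇔)
open import Function.Properties.Inverse using (↔⇒↣)
open import Relation.Nullary using (¬_; ¬?; yes; no; does; contradiction)
open import Relation.Nullary.Decidable using (_×-dec_; dec-true; dec-false)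
open import Relation.Binary.PropositionalEquality
  using (_≡_; _≢_; _≗_; refl; sym; trans; cong; cong₂; subst; subst₂; module ≡-Reasoning)

private variable
  k m n : ℕ

x∈p─q⇒x∉q : ∀ (p q : Subset n) {x} → x ∈ p ─ q → x ∉ q
x∈p─q⇒x∉q (true ∷ p) (false ∷ q) here       ()
x∈p─q⇒x∉q (_    ∷ p) (_     ∷ q) (there x∈) (there x∈q) = x∈p─q⇒x∉q p q x∈ x∈q

does-≟-comm : (a b : Fin k) → does (a ≟ b) ≡ does (b ≟ a)
does-≟-comm a b with a ≟ b
... | yes refl = sym (dec-true (a ≟ a) refl)
... | no  a≢b  = sym (dec-false (b ≟ a) (a≢b ∘ sym))

Separated-sym : {G : Graph n} {S : Subset n} {u v : Fin n} →
                Separated G S u v → Separated G S v u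
Separated-sym sep H = sep λ w w∈S → swap (H w w∈S)

IsLD-mono : {G : Graph n} {S T : Subset n} → S ⊆ T → IsLD G S → IsLD G T
IsLD-mono S⊆T (dominated , separated) =
  (λ v v∉T → let w , w∈S , v~w = dominated v (v∉T ∘ S⊆T) in w , S⊆T w∈S , v~w) ,
  (λ u v u∉T v∉T u≢v H →
     separated u v (u∉T ∘ S⊆T) (v∉T ∘ S⊆T) u≢v λ w w∈S → H w (S⊆T w∈S))

-- Lower bound

AgreeOn : Subset n → (Fin n → Bool) → (Fin n → Bool) → Set
AgreeOn S f g = ∀ w → w ∈ S → f w ≡ g w

AgreeOn-sym : {S : Subset n} {f g : Fin n → Bool} → AgreeOn S f g → AgreeOn S g f
AgreeOn-sym agree w w∈S = sym (agree w w∈S)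

trace : (S : Subset n) → (Fin n → Bool) → Subset ∣ S ∣
trace []          f = []
trace (true  ∷ S) f = f zero ∷ trace S (f ∘ suc)
trace (false ∷ S) f = trace S (f ∘ suc)

trace-injective : ∀ (S : Subset n) {f g} → trace S f ≡ trace S g → AgreeOn S f g
trace-injective (true  ∷ S) eq zero    here        = proj₁ (∷-injective eq)
trace-injective (true  ∷ S) eq (suc w) (there w∈S) =
  trace-injective S (proj₂ (∷-injective eq)) w w∈S
trace-injective (false ∷ S) eq (suc w) (there w∈S) = trace-injective S eq w w∈S

encode : Subset k → Fin (2 ^ k)
encode []          = zero
encode (false ∷ p) = combine {2} zero       (encode p)
encode (true  ∷ p) = combine {2} (suc zero) (encode p)

encode-injective : (p q : Subset k) → encode p ≡ encode q → p ≡ q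
encode-injective []          []          _  = refl
encode-injective (false ∷ p) (false ∷ q) eq =
  cong (false ∷_) (encode-injective p q (combine-injectiveʳ {2} zero _ zero _ eq))
encode-injective (true  ∷ p) (true  ∷ q) eq =
  cong (true ∷_) (encode-injective p q (combine-injectiveʳ {2} (suc zero) _ (suc zero) _ eq))
encode-injective (false ∷ p) (true  ∷ q) eq
  with () ← combine-injectiveˡ {2} zero (encode p) (suc zero) (encode q) eq
encode-injective (true  ∷ p) (false ∷ q) eq
  with () ← combine-injectiveˡ {2} (suc zero) (encode p) zero (encode q) eq

distinctOn⇒≤2^∣S∣ : (S : Subset n) (σ : Fin m → Fin n → Bool) →
                    (∀ i j → AgreeOn S (σ i) (σ j) → i ≡ j) → m ≤ 2 ^ ∣ S ∣
distinctOn⇒≤2^∣S∣ S σ distinct = injective⇒≤ λ {i} {j} eq →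
  distinct i j (trace-injective S (encode-injective _ _ eq))

signature : Graph n → Subset n → Fin n → Fin n → Bool
signature G S v with v ∈? S
... | yes _ = λ w → does (v ≟ w)
... | no  _ = adj G v

module _ (G : Graph n) {S : Subset n} (red : IsREDLD G S) where

  signature-nonempty : ∀ v → ¬ AgreeOn S (λ _ → false) (signature G S v)
  signature-nonempty v agree with v ∈? S
  ... | yes v∈S with () ← trans (agree v v∈S) (dec-true (v ≟ v) refl)
  ... | no  v∉S with w , w∈S , v~w ← proj₁ (proj₁ red) v v∉S
                with () ← trans (agree w w∈S) v~w

  -- Redundancy is used exactly here: v is still dominated once u leaves S.
  signature-mixed : ∀ u v → u ∈ S → v ∉ S → ¬ AgreeOn S (λ w → does (u ≟ w)) (adj G v)
  signature-mixed u v u∈S v∉S agree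
    with w , w∈S-u , v~w ← proj₁ (proj₂ red u u∈S) v (v∉S ∘ p─q⊆p S ⁅ u ⁆)
    with () ← trans (sym (dec-false (u ≟ w) (x∉⁅y⁆⇒x≢y (x∈p─q⇒x∉q S ⁅ u ⁆ w∈S-u) ∘ sym)))
                    (trans (agree w (p─q⊆p S ⁅ u ⁆ w∈S-u)) v~w)

  signature-injective : ∀ u v → AgreeOn S (signature G S u) (signature G S v) → u ≡ v
  signature-injective u v agree with u ∈? S | v ∈? S
  ... | yes u∈S | yes v∈S with u ≟ v | agree v v∈S
  ...   | yes u≡v | _  = u≡v
  ...   | no  _   | eq with () ← trans eq (dec-true (v ≟ v) refl)
  signature-injective u v agree | yes u∈S | no v∉S =
    contradiction agree (signature-mixed u v u∈S v∉S)
  signature-injective u v agree | no u∉S | yes v∈S =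
    contradiction (AgreeOn-sym agree) (signature-mixed v u v∈S u∉S)
  signature-injective u v agree | no u∉S | no v∉S with u ≟ v
  ... | yes u≡v = u≡v
  ... | no  u≢v = contradiction
    (λ w w∈S → trans (sym (agree w w∈S)) , trans (agree w w∈S))
    (proj₂ (proj₁ red) u v u∉S v∉S u≢v)

  n<2^∣S∣ : n < 2 ^ ∣ S ∣
  n<2^∣S∣ = distinctOn⇒≤2^∣S∣ S σ σ-injective
    where
      σ : Fin (suc n) → Fin n → Bool
      σ zero    = λ _ → false
      σ (suc v) = signature G S v

      σ-injective : ∀ i j → AgreeOn S (σ i) (σ j) → i ≡ j
      σ-injective zero    zero    _     = refl
      σ-injective zero    (suc v) agree = contradiction agree (signature-nonempty v)
      σ-injective (suc u) zero    agree = contradiction (AgreeOn-sym agree) (signature-nonempty u)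
      σ-injective (suc u) (suc v) agree = cong suc (signature-injective u v agree)

IsREDLD⇒k<∣T∣ : (G : Graph n) → 2 ^ k ≤ n → ∀ T → IsREDLD G T → suc k ≤ ∣ T ∣
IsREDLD⇒k<∣T∣ G 2^k≤n T red =
  ≰⇒> λ ∣T∣≤k → <⇒≱ (≤-<-trans 2^k≤n (n<2^∣S∣ G red)) (^-monoʳ-≤ 2 ∣T∣≤k)

-- Even-weight words

parity : (Fin m → Bool) → Bool
parity {zero}  f = false
parity {suc m} f = f zero xor parity (f ∘ suc)

parityExtend : (Fin m → Bool) → Fin (suc m) → Bool
parityExtend f zero    = parity f
parityExtend f (suc i) = f i

parity-cong : {f g : Fin m → Bool} → f ≗ g → parity f ≡ parity g
parity-cong {zero}  f≗g = refl
parity-cong {suc m} f≗g = cong₂ _xor_ (f≗g zero) (parity-cong (f≗g ∘ suc))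

parity-falses : parity (λ (_ : Fin m) → false) ≡ false
parity-falses {zero}  = refl
parity-falses {suc m} = parity-falses {m}

parity-trues-even : ∀ j → parity (λ (_ : Fin (2 * j)) → true) ≡ false
parity-trues-even zero    = refl
parity-trues-even (suc j) rewrite +-suc j (j + 0) =
  trans (Bool.not-involutive _) (parity-trues-even j)

parity-trues⇒1≤ : parity (λ (_ : Fin m) → true) ≡ true → 1 ≤ m
parity-trues⇒1≤ {suc m} _ = s≤s z≤n

parity-flip : {f g : Fin m → Bool} (i : Fin m) → g i ≡ not (f i) →
              (∀ w → w ≢ i → g w ≡ f w) → parity g ≡ not (parity f)
parity-flip {f = f} {g} zero gi agree = begin
  g zero xor parity (g ∘ suc)        ≡⟨ cong₂ _xor_ gi (parity-cong λ w → agree (suc w) λ ()) ⟩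
  not (f zero) xor parity (f ∘ suc)  ≡⟨ not-distribˡ-xor (f zero) _ ⟨
  not (parity f)                     ∎
  where open ≡-Reasoning
parity-flip {f = f} {g} (suc i) gi agree = begin
  g zero xor parity (g ∘ suc)        ≡⟨ cong₂ _xor_ (agree zero λ ()) (parity-flip i gi agree∘suc) ⟩
  f zero xor not (parity (f ∘ suc))  ≡⟨ not-distribʳ-xor (f zero) _ ⟨
  not (parity f)                     ∎
  where
    open ≡-Reasoning
    agree∘suc : ∀ w → w ≢ i → g (suc w) ≡ f (suc w)
    agree∘suc w w≢i = agree (suc w) (w≢i ∘ suc-injective)

another-difference⊎parity≢ : {f g : Fin m → Bool} {i : Fin m} → f i ≢ g i →
                              ∃[ w ] (w ≢ i × f w ≢ g w) ⊎ parity f ≢ parity g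
another-difference⊎parity≢ {f = f} {g} {i} fi≢gi
  with any? (λ w → ¬? (w ≟ i) ×-dec ¬? (f w Bool.≟ g w))
... | yes found = inj₁ found
... | no  none  = inj₂ λ pf≡pg →
  not-¬ refl (trans pf≡pg (parity-flip i (¬-not (fi≢gi ∘ sym)) agree))
  where
    agree : ∀ w → w ≢ i → g w ≡ f w
    agree w w≢i with f w Bool.≟ g w
    ... | yes fw≡gw = sym fw≡gw
    ... | no  fw≢gw = contradiction (w , w≢i , fw≢gw) none

-- Hamming distance at least two: no single coordinate accounts for all differences.
Distance≥2 : (f g : Fin k → Bool) → Set
Distance≥2 f g = ∀ a → ∃[ c ] (c ≢ a × f c ≢ g c)

Distance≥2-respʳ : {f g h : Fin k → Bool} → g ≗ h → Distance≥2 f g → Distance≥2 f h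
Distance≥2-respʳ g≗h far a with c , c≢a , fc≢gc ← far a =
  c , c≢a , λ fc≡hc → fc≢gc (trans fc≡hc (sym (g≗h c)))

parityExtend-distance≥2 : {f g : Fin m → Bool} {i : Fin m} → f i ≢ g i →
                          Distance≥2 (parityExtend f) (parityExtend g)
parityExtend-distance≥2 {i = i} fi≢gi zero = suc i , (λ ()) , fi≢gi
parityExtend-distance≥2 {i = i} fi≢gi (suc a) with a ≟ i
... | no a≢i = suc i , a≢i ∘ sym ∘ suc-injective , fi≢gi
... | yes refl with another-difference⊎parity≢ fi≢gi
...   | inj₁ (w , w≢a , fw≢gw) = suc w , w≢a ∘ suc-injective , fw≢gw
...   | inj₂ pf≢pg              = zero , (λ ()) , pf≢pg

¬≗⇒∃≢ : {f g : Fin m → Bool} → ¬ f ≗ g → ∃[ i ] f i ≢ g i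
¬≗⇒∃≢ {m} {f} {g} = ¬∀⟶∃¬ m _ λ i → f i Bool.≟ g i

funToFin-cong : {f g : Fin m → Fin n} → f ≗ g → funToFin f ≡ funToFin g
funToFin-cong {zero}  _   = refl
funToFin-cong {suc m} f≗g = cong₂ combine (f≗g zero) (funToFin-cong (f≗g ∘ suc))

finToFun≗⇒≡funToFin : {t : Fin (n ^ m)} {f : Fin m → Fin n} → finToFun t ≗ f → t ≡ funToFin f
finToFun≗⇒≡funToFin {n} {m} {t} eq = trans (sym (funToFin-finToFin {m} {n} t)) (funToFin-cong eq)

toℕ-funToFin-zeros : toℕ (funToFin {m} {suc n} λ _ → zero) ≡ 0
toℕ-funToFin-zeros {zero}  = refl
toℕ-funToFin-zeros {suc m} = trans (toℕ-↑ˡ _ _) (toℕ-funToFin-zeros {m})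

suc-toℕ-funToFin-ones : suc (toℕ (funToFin {m} {2} λ _ → suc zero)) ≡ 2 ^ m
suc-toℕ-funToFin-ones {zero}  = refl
suc-toℕ-funToFin-ones {suc m} = begin
  suc (toℕ (2 ^ m ↑ʳ (r ↑ˡ 0)))  ≡⟨ cong suc (toℕ-↑ʳ (2 ^ m) (r ↑ˡ 0)) ⟩
  suc (2 ^ m + toℕ (r ↑ˡ 0))     ≡⟨ +-suc (2 ^ m) _ ⟨
  2 ^ m + suc (toℕ (r ↑ˡ 0))     ≡⟨ cong (λ t → 2 ^ m + suc t) (toℕ-↑ˡ r 0) ⟩
  2 ^ m + suc (toℕ r)            ≡⟨ cong (2 ^ m +_) (suc-toℕ-funToFin-ones {m}) ⟩
  2 ^ m + 2 ^ m                  ≡⟨ cong (2 ^ m +_) (+-identityʳ (2 ^ m)) ⟨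
  2 ^ m + (2 ^ m + 0)            ∎
  where
    open ≡-Reasoning
    r = funToFin {m} {2} λ _ → suc zero

binaryWord : Fin (2 ^ m) → Fin m → Bool
binaryWord t = Inverse.to 2↔Bool ∘ finToFun t

private
  binaryWord≗⇒≡funToFin : {t : Fin (2 ^ m)} {f : Fin m → Fin 2} →
                           binaryWord t ≗ Inverse.to 2↔Bool ∘ f → t ≡ funToFin f
  binaryWord≗⇒≡funToFin eq = finToFun≗⇒≡funToFin (Injection.injective (↔⇒↣ 2↔Bool) ∘ eq)

binaryWord-injective : {t t′ : Fin (2 ^ m)} → binaryWord t ≗ binaryWord t′ → t ≡ t′
binaryWord-injective {m} {t′ = t′} eq =
  trans (binaryWord≗⇒≡funToFin {m} eq) (funToFin-finToFin {m} {2} t′)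

binaryWord-zeros : {t : Fin (2 ^ m)} → binaryWord t ≗ (λ _ → false) → toℕ t ≡ 0
binaryWord-zeros {m} eq =
  trans (cong toℕ (binaryWord≗⇒≡funToFin {m} eq)) (toℕ-funToFin-zeros {m})

binaryWord-ones : {t : Fin (2 ^ m)} → binaryWord t ≗ (λ _ → true) → suc (toℕ t) ≡ 2 ^ m
binaryWord-ones {m} eq =
  trans (cong (suc ∘ toℕ) (binaryWord≗⇒≡funToFin {m} eq)) (suc-toℕ-funToFin-ones {m})

module Codewords {m} (2≤2^m : 2 ≤ 2 ^ m) where

  private
    N = 2 ^ m ∸ 2

    3+x≤2^m : (x : Fin N) → 3 + toℕ x ≤ 2 ^ m
    3+x≤2^m x = subst₂ _≤_ (+-comm (suc (toℕ x)) 2) (m∸n+n≡m 2≤2^m) (+-monoˡ-≤ 2 (toℕ<n x))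

  -- The numbers 1 … 2^m - 2, whose binary words avoid the all-zeros and the all-ones word.
  number : Fin N → Fin (2 ^ m)
  number x = fromℕ< (<⇒≤ (3+x≤2^m x))

  number-injective : ∀ x y → number x ≡ number y → x ≡ y
  number-injective x y eq = toℕ-injective (ℕ.suc-injective (fromℕ<-injective _ _ _ _ eq))

  codeword : Fin N → Fin (suc m) → Bool
  codeword x = parityExtend (binaryWord (number x))

  codeword-distance-falses : ∀ x → Distance≥2 (codeword x) (λ _ → false)
  codeword-distance-falses x =
    Distance≥2-respʳ parityExtend-falses (parityExtend-distance≥2 (proj₂ (¬≗⇒∃≢ nonzero)))
    where
      nonzero : ¬ binaryWord (number x) ≗ (λ _ → false)
      nonzero eq with () ← trans (sym (toℕ-fromℕ< _)) (binaryWord-zeros {m} eq)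

      parityExtend-falses : parityExtend (λ (_ : Fin m) → false) ≗ (λ _ → false)
      parityExtend-falses zero    = parity-falses {m}
      parityExtend-falses (suc _) = refl

  codeword-distance-trues : parity (λ (_ : Fin m) → true) ≡ true →
                            ∀ x → Distance≥2 (codeword x) (λ _ → true)
  codeword-distance-trues odd x =
    Distance≥2-respʳ parityExtend-trues (parityExtend-distance≥2 (proj₂ (¬≗⇒∃≢ notOnes)))
    where
      notOnes : ¬ binaryWord (number x) ≗ (λ _ → true)
      notOnes eq =
        <-irrefl (trans (cong suc (sym (toℕ-fromℕ< _))) (binaryWord-ones {m} eq)) (3+x≤2^m x)

      parityExtend-trues : parityExtend (λ (_ : Fin m) → true) ≗ (λ _ → true)
      parityExtend-trues zero    = odd
      parityExtend-trues (suc _) = refl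

  codeword-distance : ∀ x y → x ≢ y → Distance≥2 (codeword x) (codeword y)
  codeword-distance x y x≢y = parityExtend-distance≥2
    (proj₂ (¬≗⇒∃≢ (x≢y ∘ number-injective x y ∘ binaryWord-injective {m})))

-- The clique with codeword neighbourhoods

another : 1 < k → (a : Fin k) → ∃[ c ] c ≢ a
another (s≤s (s≤s _)) zero    = suc zero , λ ()
another (s≤s (s≤s _)) (suc _) = zero , λ ()

∣⊤++p∣ : (p : Subset n) → ∣ ⊤ {k} ++ p ∣ ≡ k + ∣ p ∣
∣⊤++p∣ {k = zero}  p = refl
∣⊤++p∣ {k = suc k} p = cong suc (∣⊤++p∣ {k = k} p)

↑ˡ∈⊤++p : (p : Subset n) (a : Fin k) → a ↑ˡ n ∈ ⊤ ++ p
↑ˡ∈⊤++p p zero    = here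
↑ˡ∈⊤++p p (suc a) = there (↑ˡ∈⊤++p p a)

↑ʳ∉p++⊥ : (p : Subset k) (x : Fin n) → k ↑ʳ x ∉ p ++ ⊥
↑ʳ∉p++⊥ []      x = ∉⊥
↑ʳ∉p++⊥ (_ ∷ p) x (there x∈) = ↑ʳ∉p++⊥ p x x∈

module CliqueWithCodewords {k N} (word : Fin N → Fin k → Bool) where

  adjacency : Fin k ⊎ Fin N → Fin k ⊎ Fin N → Bool
  adjacency (inj₁ a) (inj₁ b) = not (does (a ≟ b))
  adjacency (inj₁ a) (inj₂ y) = word y a
  adjacency (inj₂ x) (inj₁ b) = word x b
  adjacency (inj₂ _) (inj₂ _) = false

  adjacency-sym : ∀ s t → adjacency s t ≡ adjacency t s
  adjacency-sym (inj₁ a) (inj₁ b) = cong not (does-≟-comm a b)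
  adjacency-sym (inj₁ _) (inj₂ _) = refl
  adjacency-sym (inj₂ _) (inj₁ _) = refl
  adjacency-sym (inj₂ _) (inj₂ _) = refl

  adjacency-irreflexive : ∀ s → adjacency s s ≡ false
  adjacency-irreflexive (inj₁ a) = cong not (dec-true (a ≟ a) refl)
  adjacency-irreflexive (inj₂ _) = refl

  graph : Graph (k + N)
  graph = record
    { adj   = λ u v → adjacency (splitAt k u) (splitAt k v)
    ; sym   = λ u v → adjacency-sym (splitAt k u) (splitAt k v)
    ; irrfl = λ v → adjacency-irreflexive (splitAt k v)
    }

  clique : Subset (k + N)
  clique = ⊤ {k} ++ ⊥ {N}

  ∣clique∣ : ∣ clique ∣ ≡ k
  ∣clique∣ = trans (∣⊤++p∣ {k = k} ⊥) (trans (cong (k +_) (∣⊥∣≡0 N)) (+-identityʳ k))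

  data View : Fin (k + N) → Set where
    clique-vertex : (a : Fin k) → View (a ↑ˡ N)
    code-vertex   : (x : Fin N) → View (k ↑ʳ x)

  view : ∀ v → View v
  view v with splitAt k v in eq
  ... | inj₁ a = subst View (splitAt⁻¹-↑ˡ eq) (clique-vertex a)
  ... | inj₂ x = subst View (splitAt⁻¹-↑ʳ eq) (code-vertex x)

  adj-clique : ∀ a b → adj graph (a ↑ˡ N) (b ↑ˡ N) ≡ not (does (a ≟ b))
  adj-clique a b rewrite splitAt-↑ˡ k a N | splitAt-↑ˡ k b N = refl

  adj-code : ∀ x b → adj graph (k ↑ʳ x) (b ↑ˡ N) ≡ word x b
  adj-code x b rewrite splitAt-↑ʳ k N x | splitAt-↑ˡ k b N = refl

  module _ (1<k : 1 < k)
           (far-falses : ∀ x → Distance≥2 (word x) (λ _ → false))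
           (far-trues  : ∀ x → Distance≥2 (word x) (λ _ → true))
           (far        : ∀ x y → x ≢ y → Distance≥2 (word x) (word y))
    where

    module _ (a : Fin k) where

      private
        S = clique - (a ↑ˡ N)

        ∈S : ∀ {c} → c ≢ a → c ↑ˡ N ∈ S
        ∈S c≢a = x∈p∧x≢y⇒x∈p-y (↑ˡ∈⊤++p ⊥ _) (c≢a ∘ ↑ˡ-injective N _ a)

        ∉S⇒≡a : ∀ b → b ↑ˡ N ∉ S → b ≡ a
        ∉S⇒≡a b b∉S with b ≟ a
        ... | yes b≡a = b≡a
        ... | no  b≢a = contradiction (∈S b≢a) b∉S

        a~ : ∀ {c} → c ≢ a → Adj graph (a ↑ˡ N) (c ↑ˡ N)
        a~ {c} c≢a = trans (adj-clique a c) (cong not (dec-false (a ≟ c) (c≢a ∘ sym)))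

        a-separated : ∀ y → Separated graph S (a ↑ˡ N) (k ↑ʳ y)
        a-separated y H with c , c≢a , yc≢true ← far-trues y a =
          yc≢true (trans (sym (adj-code y c)) (proj₁ (H (c ↑ˡ N) (∈S c≢a)) (a~ c≢a)))

      clique-minus-dominated : ∀ v → v ∉ S → Dominated graph S v
      clique-minus-dominated v v∉S with view v
      ... | clique-vertex b with refl ← ∉S⇒≡a b v∉S
                            with c , c≢a ← another 1<k a = c ↑ˡ N , ∈S c≢a , a~ c≢a
      ... | code-vertex x with c , c≢a , xc≢false ← far-falses x a =
        c ↑ˡ N , ∈S c≢a , trans (adj-code x c) (¬-not xc≢false)

      clique-minus-separated : ∀ u v → u ∉ S → v ∉ S → u ≢ v → Separated graph S u v
      clique-minus-separated u v u∉S v∉S u≢v with view u | view v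
      ... | clique-vertex b | clique-vertex b′ =
        contradiction (cong (_↑ˡ N) (trans (∉S⇒≡a b u∉S) (sym (∉S⇒≡a b′ v∉S)))) u≢v
      ... | clique-vertex b | code-vertex y with refl ← ∉S⇒≡a b u∉S = a-separated y
      ... | code-vertex x | clique-vertex b with refl ← ∉S⇒≡a b v∉S =
        Separated-sym {G = graph} (a-separated x)
      ... | code-vertex x | code-vertex y = λ H →
        let c , c≢a , xc≢yc = far x y (u≢v ∘ cong (k ↑ʳ_)) a
            x~c⇔y~c         = H (c ↑ˡ N) (∈S c≢a)
        in xc≢yc (Bool.⇔→≡ (mk⇔
             (λ xc → trans (sym (adj-code y c)) (proj₁ x~c⇔y~c (trans (adj-code x c) xc)))
             (λ yc → trans (sym (adj-code x c)) (proj₂ x~c⇔y~c (trans (adj-code y c) yc)))))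

      clique-minus-isLD : IsLD graph S
      clique-minus-isLD = clique-minus-dominated , clique-minus-separated

    clique-isREDLD : IsREDLD graph clique
    clique-isREDLD =
      IsLD-mono {G = graph} (p─q⊆p clique ⁅ a₁ ↑ˡ N ⁆) (clique-minus-isLD a₁) , minus-isLD
      where
        a₁ = fromℕ< 1<k

        minus-isLD : ∀ v → v ∈ clique → IsLD graph (clique - v)
        minus-isLD v v∈clique with view v
        ... | clique-vertex a = clique-minus-isLD a
        ... | code-vertex x   = contradiction v∈clique (↑ʳ∉p++⊥ ⊤ x)

clique-with-codewords-REDLDNumber : ∀ m → parity (λ (_ : Fin m) → true) ≡ true →
                                    ∃[ G ] REDLDNumberIs {suc m + (2 ^ m ∸ 2)} G (suc m)
clique-with-codewords-REDLDNumber m odd =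
  graph ,
  (clique , clique-isREDLD (s≤s 1≤m) codeword-distance-falses
                           (codeword-distance-trues odd) codeword-distance , ∣clique∣) ,
  IsREDLD⇒k<∣T∣ graph 2^m≤n
  where
    1≤m : 1 ≤ m
    1≤m = parity-trues⇒1≤ odd

    2≤2^m : 2 ≤ 2 ^ m
    2≤2^m = ^-monoʳ-≤ 2 1≤m

    open Codewords {m} 2≤2^m
    open CliqueWithCodewords codeword

    2^m≤n : 2 ^ m ≤ suc m + (2 ^ m ∸ 2)
    2^m≤n = begin
      2 ^ m               ≡⟨ m∸n+n≡m 2≤2^m ⟨
      2 ^ m ∸ 2 + 2       ≤⟨ +-monoʳ-≤ (2 ^ m ∸ 2) (s≤s 1≤m) ⟩
      2 ^ m ∸ 2 + suc m   ≡⟨ +-comm (2 ^ m ∸ 2) (suc m) ⟩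
      suc m + (2 ^ m ∸ 2) ∎
      where open ≤-Reasoning

theorem4 : (j : ℕ) → let k = 2 * suc j in
    ∃[ G ] REDLDNumberIs {2 ^ (k ∸ 1) + k ∸ 2} G k
theorem4 j =
  subst (λ n → ∃[ G ] REDLDNumberIs {n} G (suc d)) order (clique-with-codewords-REDLDNumber d odd)
  where
    d : ℕ
    d = 2 * suc j ∸ 1

    odd : parity (λ (_ : Fin d) → true) ≡ true
    odd rewrite +-suc j (j + 0) | parity-trues-even j = refl

    order : suc d + (2 ^ d ∸ 2) ≡ 2 ^ d + suc d ∸ 2
    order = trans (sym (+-∸-assoc (suc d) (^-monoʳ-≤ 2 (parity-trues⇒1≤ {d} odd))))
                  (cong (_∸ 2) (+-comm (suc d) (2 ^ d)))
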